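{- Let $a,b,c,d$ be distinct vertices in a graph $H$. For every graph $H^+$, $H^+$ contains a $K_4$-minor rooted at $a,b,c,d$ if and only if $H$ contains a $K_4$-minor rooted at $a,b,c,d$.
   Context: Graphs are finite, simple and undirected. For a graph $H$, $H^+$ denotes any graph obtained from $H$ by adding, for each triangle $T$ of $H$, a (possibly empty) clique $X_T$, these cliques being pairwise disjoint and disjoint from $H$, with every vertex of $X_T$ joined to every vertex of $T$ and no other edges added. A $K_4$-minor rooted at $a,b,c,d$ in a graph is a set of four pairwise vertex-disjoint connected subgraphs, respectively containing $a,b,c,d$, every two of which are joined by an edge. -}

module Defs where

open import Data.Nat using (ℕ; _+_)
open import Data.Fin using (Fin; splitAt; _↑ˡ_)
open import Data.Sum using (_⊎_; inj₁; inj₂)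
open import Data.Product using (_×_; _,_; Σ; ∃; proj₁; proj₂)
open import Data.Empty using (⊥)
open import Relation.Nullary using (¬_)
open import Relation.Binary.PropositionalEquality using (_≡_; _≢_; refl; sym)
open import Relation.Unary using (Pred)
import Level
open import Function.Bundles using (_⇔_; mk⇔; Equivalence)

record Graph (n : ℕ) : Set₁ where
  field
    _~_    : Fin n → Fin n → Set
    ~-sym  : ∀ {x y} → x ~ y → y ~ x
    ~-irr  : ∀ {x} → ¬ (x ~ x)
open Graph public

record Triangle {n : ℕ} (H : Graph n) : Set where
  constructor triangle
  field
    t₁ t₂ t₃ : Fin n
    e₁₂ : _~_ H t₁ t₂
    e₂₃ : _~_ H t₂ t₃
    e₁₃ : _~_ H t₁ t₃
open Triangle public

_∈T_ : ∀ {n} {H : Graph n} → Fin n → Triangle H → Set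
v ∈T T = v ≡ t₁ T ⊎ v ≡ t₂ T ⊎ v ≡ t₃ T

SameT : ∀ {n} {H : Graph n} → Triangle H → Triangle H → Set
SameT T T' = ∀ v → (v ∈T T) ⇔ (v ∈T T')

SameT-sym : ∀ {n} {H : Graph n} {T T' : Triangle H} → SameT T T' → SameT T' T
SameT-sym p v = mk⇔ (Equivalence.from (p v)) (Equivalence.to (p v))

-- H⁺: vertices Fin (n + m); the first n vertices (u ↑ˡ m) form a copy of H,
-- the extra vertex i : Fin m belongs to the clique X_{τ i} of triangle τ i.
-- Thus X_T = { i | τ i is the triangle T } (possibly empty), these cliques are
-- pairwise disjoint, each is joined completely to its triangle, and nothing else.
module Plus {n : ℕ} (H : Graph n) (m : ℕ) (τ : Fin m → Triangle H) where

  Adj' : Fin n ⊎ Fin m → Fin n ⊎ Fin m → Set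
  Adj' (inj₁ u) (inj₁ v) = _~_ H u v
  Adj' (inj₁ u) (inj₂ i) = u ∈T τ i
  Adj' (inj₂ i) (inj₁ u) = u ∈T τ i
  Adj' (inj₂ i) (inj₂ j) = i ≢ j × SameT (τ i) (τ j)

  Adj'-sym : ∀ x y → Adj' x y → Adj' y x
  Adj'-sym (inj₁ u) (inj₁ v) e = ~-sym H e
  Adj'-sym (inj₁ u) (inj₂ i) e = e
  Adj'-sym (inj₂ i) (inj₁ u) e = e
  Adj'-sym (inj₂ i) (inj₂ j) (ne , s) = (λ eq → ne (sym eq)) , SameT-sym {T = τ i} {T' = τ j} s

  Adj'-irr : ∀ x → ¬ Adj' x x
  Adj'-irr (inj₁ u) e = ~-irr H e
  Adj'-irr (inj₂ i) (ne , _) = ne refl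

  graph : Graph (n + m)
  graph = record
    { _~_   = λ x y → Adj' (splitAt n x) (splitAt n y)
    ; ~-sym = λ {x} {y} → Adj'-sym (splitAt n x) (splitAt n y)
    ; ~-irr = λ {x} → Adj'-irr (splitAt n x)
    }

_⁺[_,_] : ∀ {n} (H : Graph n) (m : ℕ) → (Fin m → Triangle H) → Graph (n + m)
H ⁺[ m , τ ] = Plus.graph H m τ

emb : ∀ {n} (m : ℕ) → Fin n → Fin (n + m)
emb m v = v ↑ˡ m

data WalkIn {n : ℕ} (G : Graph n) (S : Pred (Fin n) Level.zero) : Fin n → Fin n → Set where
  stop : ∀ {x} → S x → WalkIn G S x x
  step : ∀ {x y z} → S x → _~_ G x y → WalkIn G S y z → WalkIn G S x z

ConnectedIn : ∀ {n} (G : Graph n) → Pred (Fin n) Level.zero → Set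
ConnectedIn G S = ∀ x y → S x → S y → WalkIn G S x y

record K4MinorRooted {n : ℕ} (G : Graph n) (a b c d : Fin n) : Set₁ where
  field
    B₁ B₂ B₃ B₄ : Pred (Fin n) Level.zero
    conn₁ : ConnectedIn G B₁
    conn₂ : ConnectedIn G B₂
    conn₃ : ConnectedIn G B₃
    conn₄ : ConnectedIn G B₄
    root₁ : B₁ a
    root₂ : B₂ b
    root₃ : B₃ c
    root₄ : B₄ d
    disj₁₂ : ∀ v → B₁ v → B₂ v → ⊥
    disj₁₃ : ∀ v → B₁ v → B₃ v → ⊥
    disj₁₄ : ∀ v → B₁ v → B₄ v → ⊥
    disj₂₃ : ∀ v → B₂ v → B₃ v → ⊥
    disj₂₄ : ∀ v → B₂ v → B₄ v → ⊥
    disj₃₄ : ∀ v → B₃ v → B₄ v → ⊥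
    join₁₂ : Σ (Fin n) λ u → Σ (Fin n) λ v → B₁ u × B₂ v × _~_ G u v
    join₁₃ : Σ (Fin n) λ u → Σ (Fin n) λ v → B₁ u × B₃ v × _~_ G u v
    join₁₄ : Σ (Fin n) λ u → Σ (Fin n) λ v → B₁ u × B₄ v × _~_ G u v
    join₂₃ : Σ (Fin n) λ u → Σ (Fin n) λ v → B₂ u × B₃ v × _~_ G u v
    join₂₄ : Σ (Fin n) λ u → Σ (Fin n) λ v → B₂ u × B₄ v × _~_ G u v
    join₃₄ : Σ (Fin n) λ u → Σ (Fin n) λ v → B₃ u × B₄ v × _~_ G u v

-- Anchor every vertex of H⁺ at a vertex of H: a vertex of H at itself, a vertex of
-- the clique X_T at any vertex of T. Since T is a clique and X_T only sees T and
-- X_T, adjacent vertices of H⁺ have equal or adjacent anchors. Hence a walk inside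
-- a branch set B projects to a walk inside B ∩ H, and if B contains a vertex of H
-- then it contains an anchor of each of its vertices, so an edge between two
-- branch sets yields an edge between their traces on H. Thus intersecting the
-- branch sets of a rooted K4 minor of H⁺ with H gives one of H; conversely H is an
-- induced subgraph of H⁺.
module Submission where

open import Defs
open import Data.Nat using (ℕ; _+_)
open import Data.Fin using (Fin; splitAt; _↑ˡ_; _≟_)
open import Data.Fin.Properties using (splitAt-↑ˡ; splitAt⁻¹-↑ˡ; ↑ˡ-injective)
open import Data.Sum using (_⊎_; inj₁; inj₂; [_,_])
open import Data.Product using (_×_; _,_; Σ)
open import Data.Empty using (⊥; ⊥-elim)
open import Function using (_∘_; id)
open import Relation.Nullary using (yes; no)
open import Relation.Binary.PropositionalEquality using (_≡_; _≢_; refl; sym; subst; subst₂)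
open import Relation.Unary using (Pred)
open import Function.Bundles using (_⇔_; mk⇔; Equivalence)
import Level

Vertices : ℕ → Set₁
Vertices k = Pred (Fin k) Level.zero

Edge-between : ∀ {k} → Graph k → Vertices k → Vertices k → Set
Edge-between G B B′ = Σ _ λ u → Σ _ λ v → B u × B′ v × _~_ G u v

WalkIn-head : ∀ {k} {G : Graph k} {S x y} → WalkIn G S x y → S x
WalkIn-head (stop s)     = s
WalkIn-head (step s _ _) = s

module _ {k k′} {G : Graph k} {G′ : Graph k′} (f : Fin k → Fin k′)
         (f-hom : ∀ {u v} → _~_ G u v → _~_ G′ (f u) (f v))
         (f-injective : ∀ {u v} → f u ≡ f v → u ≡ v) where

  image : Vertices k → Vertices k′
  image B x = Σ _ λ u → f u ≡ x × B u

  WalkIn-map : ∀ {B u v} → WalkIn G B u v → WalkIn G′ (image B) (f u) (f v)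
  WalkIn-map (stop s)     = stop (_ , refl , s)
  WalkIn-map (step s e w) = step (_ , refl , s) (f-hom e) (WalkIn-map w)

  ConnectedIn-image : ∀ {B} → ConnectedIn G B → ConnectedIn G′ (image B)
  ConnectedIn-image c _ _ (u , refl , bu) (v , refl , bv) = WalkIn-map (c u v bu bv)

  image-disjoint : ∀ {B B′} → (∀ v → B v → B′ v → ⊥) → ∀ x → image B x → image B′ x → ⊥
  image-disjoint {B′ = B′} d _ (u , refl , bu) (v , fv≡fu , bv) =
    d u bu (subst B′ (f-injective fv≡fu) bv)

  image-edge-between : ∀ {B B′} → Edge-between G B B′ → Edge-between G′ (image B) (image B′)
  image-edge-between (u , v , bu , bv , e) = f u , f v , (u , refl , bu) , (v , refl , bv) , f-hom e

  K4MinorRooted-image : ∀ {a b c d} → K4MinorRooted G a b c d → K4MinorRooted G′ (f a) (f b) (f c) (f d)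
  K4MinorRooted-image K = record
    { B₁ = image B₁ ; B₂ = image B₂ ; B₃ = image B₃ ; B₄ = image B₄
    ; conn₁ = ConnectedIn-image conn₁ ; conn₂ = ConnectedIn-image conn₂
    ; conn₃ = ConnectedIn-image conn₃ ; conn₄ = ConnectedIn-image conn₄
    ; root₁ = _ , refl , root₁ ; root₂ = _ , refl , root₂ ; root₃ = _ , refl , root₃ ; root₄ = _ , refl , root₄
    ; disj₁₂ = image-disjoint disj₁₂ ; disj₁₃ = image-disjoint disj₁₃ ; disj₁₄ = image-disjoint disj₁₄
    ; disj₂₃ = image-disjoint disj₂₃ ; disj₂₄ = image-disjoint disj₂₄ ; disj₃₄ = image-disjoint disj₃₄
    ; join₁₂ = image-edge-between join₁₂ ; join₁₃ = image-edge-between join₁₃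
    ; join₁₄ = image-edge-between join₁₄ ; join₂₃ = image-edge-between join₂₃
    ; join₂₄ = image-edge-between join₂₄ ; join₃₄ = image-edge-between join₃₄
    }
    where open K4MinorRooted K

module _ {n} (H : Graph n) where

  triangle-adjacent : (T : Triangle H) {p q : Fin n} → p ∈T T → q ∈T T → p ≢ q → _~_ H p q
  triangle-adjacent T (inj₁ refl)        (inj₁ refl)        p≢q = ⊥-elim (p≢q refl)
  triangle-adjacent T (inj₁ refl)        (inj₂ (inj₁ refl)) _   = e₁₂ T
  triangle-adjacent T (inj₁ refl)        (inj₂ (inj₂ refl)) _   = e₁₃ T
  triangle-adjacent T (inj₂ (inj₁ refl)) (inj₁ refl)        _   = ~-sym H (e₁₂ T)
  triangle-adjacent T (inj₂ (inj₁ refl)) (inj₂ (inj₁ refl)) p≢q = ⊥-elim (p≢q refl)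
  triangle-adjacent T (inj₂ (inj₁ refl)) (inj₂ (inj₂ refl)) _   = e₂₃ T
  triangle-adjacent T (inj₂ (inj₂ refl)) (inj₁ refl)        _   = ~-sym H (e₁₃ T)
  triangle-adjacent T (inj₂ (inj₂ refl)) (inj₂ (inj₁ refl)) _   = ~-sym H (e₂₃ T)
  triangle-adjacent T (inj₂ (inj₂ refl)) (inj₂ (inj₂ refl)) p≢q = ⊥-elim (p≢q refl)

  emb-hom : ∀ m (τ : Fin m → Triangle H) {u v} → _~_ H u v → _~_ (H ⁺[ m , τ ]) (emb m u) (emb m v)
  emb-hom m τ {u} {v} = subst₂ (Plus.Adj' H m τ) (sym (splitAt-↑ˡ n u m)) (sym (splitAt-↑ˡ n v m))

  module _ (m : ℕ) (τ : Fin m → Triangle H) where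
    open Plus H m τ using (Adj')

    data Anchor : Fin n ⊎ Fin m → Fin n → Set where
      itself      : ∀ u → Anchor (inj₁ u) u
      on-triangle : ∀ {i p} → p ∈T τ i → Anchor (inj₂ i) p

    anchor-step : ∀ {s t p} → Adj' s t → Anchor s p →
                  Anchor t p ⊎ Σ (Fin n) λ q → t ≡ inj₁ q × _~_ H p q
    anchor-step {t = inj₁ q} e     (itself _) = inj₂ (q , refl , e)
    anchor-step {t = inj₂ j} p∈τj  (itself _) = inj₁ (on-triangle p∈τj)
    anchor-step {t = inj₁ q} q∈τi  (on-triangle {p = p} p∈τi) with p ≟ q
    ... | yes refl = inj₁ (itself p)
    ... | no  p≢q  = inj₂ (q , refl , triangle-adjacent (τ _) p∈τi q∈τi p≢q)
    anchor-step {t = inj₂ j} (_ , τi≈τj) (on-triangle {p = p} p∈τi) =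
      inj₁ (on-triangle (Equivalence.to (τi≈τj p) p∈τi))

    anchors-equal-or-adjacent : ∀ {s p q} → Anchor s p → Anchor s q → p ≡ q ⊎ _~_ H p q
    anchors-equal-or-adjacent (itself _) (itself _) = inj₁ refl
    anchors-equal-or-adjacent (on-triangle {p = p} p∈τi) (on-triangle {p = q} q∈τi) with p ≟ q
    ... | yes p≡q = inj₁ p≡q
    ... | no  p≢q = inj₂ (triangle-adjacent (τ _) p∈τi q∈τi p≢q)

    anchors-adjacent : ∀ {s t p q} → Adj' s t → Anchor s p → Anchor t q → p ≢ q → _~_ H p q
    anchors-adjacent e s⇝p t⇝q p≢q with anchor-step e s⇝p
    ... | inj₁ t⇝p = [ ⊥-elim ∘ p≢q , id ] (anchors-equal-or-adjacent t⇝p t⇝q)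
    ... | inj₂ (_ , refl , p~q) with t⇝q
    ...   | itself _ = p~q

    private
      G : Graph (n + m)
      G = H ⁺[ m , τ ]

    anchor-emb : ∀ u → Anchor (splitAt n (emb m u)) u
    anchor-emb u = subst (λ s → Anchor s u) (sym (splitAt-↑ˡ n u m)) (itself u)

    ∈-emb : ∀ {S : Vertices (n + m)} {y q} → S y → splitAt n y ≡ inj₁ q → S (emb m q)
    ∈-emb {S} s eq = subst S (sym (splitAt⁻¹-↑ˡ eq)) s

    anchor-of-old : ∀ {y q} → splitAt n y ≡ inj₁ q → Anchor (splitAt n y) q
    anchor-of-old {q = q} eq = subst (λ s → Anchor s q) (sym eq) (itself q)

    WalkIn-restrict : ∀ {S x y p q} → WalkIn G S x y →
                      Anchor (splitAt n x) p → S (emb m p) →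
                      Anchor (splitAt n y) q → S (emb m q) →
                      WalkIn H (S ∘ emb m) p q
    WalkIn-restrict (stop _) x⇝p sp x⇝q sq with anchors-equal-or-adjacent x⇝p x⇝q
    ... | inj₁ refl = stop sp
    ... | inj₂ p~q  = step sp p~q (stop sq)
    WalkIn-restrict (step _ e w) x⇝p sp y⇝q sq with anchor-step e x⇝p
    ... | inj₁ x′⇝p              = WalkIn-restrict w x′⇝p sp y⇝q sq
    ... | inj₂ (p′ , eq , p~p′) =
      step sp p~p′ (WalkIn-restrict w (anchor-of-old eq) (∈-emb (WalkIn-head w) eq) y⇝q sq)

    anchor-in-walk : ∀ {S x y q} → WalkIn G S x y → Anchor (splitAt n y) q → S (emb m q) →
                     Σ (Fin n) λ p → Anchor (splitAt n x) p × S (emb m p)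
    anchor-in-walk (stop _) y⇝q sq = _ , y⇝q , sq
    anchor-in-walk (step {x = x} {y = x′} s e w) y⇝q sq with anchor-in-walk w y⇝q sq
    ... | p , x′⇝p , sp with anchor-step (~-sym G {x} {x′} e) x′⇝p
    ...   | inj₁ x⇝p            = p , x⇝p , sp
    ...   | inj₂ (p′ , eq , _) = p′ , anchor-of-old eq , ∈-emb s eq

    ConnectedIn-restrict : ∀ {S} → ConnectedIn G S → ConnectedIn H (S ∘ emb m)
    ConnectedIn-restrict c u v su sv =
      WalkIn-restrict (c (emb m u) (emb m v) su sv) (anchor-emb u) su (anchor-emb v) sv

    anchor-in-branch : ∀ {B : Vertices (n + m)} {r x} → ConnectedIn G B → B (emb m r) → B x →
                       Σ (Fin n) λ p → Anchor (splitAt n x) p × B (emb m p)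
    anchor-in-branch {r = r} {x} c br bx = anchor-in-walk (c x (emb m r) bx br) (anchor-emb r) br

    edge-between-restrict : ∀ {B B′ : Vertices (n + m)} {r r′} →
                            ConnectedIn G B → ConnectedIn G B′ → B (emb m r) → B′ (emb m r′) →
                            (∀ v → B v → B′ v → ⊥) →
                            Edge-between G B B′ → Edge-between H (B ∘ emb m) (B′ ∘ emb m)
    edge-between-restrict c c′ br br′ disj (x , y , bx , by , e)
      with anchor-in-branch c br bx | anchor-in-branch c′ br′ by
    ... | p , x⇝p , bp | q , y⇝q , bq =
      p , q , bp , bq , anchors-adjacent e x⇝p y⇝q (λ { refl → disj _ bp bq })

    K4MinorRooted-restrict : ∀ {a b c d} →
                             K4MinorRooted G (emb m a) (emb m b) (emb m c) (emb m d) → K4MinorRooted H a b c d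
    K4MinorRooted-restrict K = record
      { B₁ = B₁ ∘ emb m ; B₂ = B₂ ∘ emb m ; B₃ = B₃ ∘ emb m ; B₄ = B₄ ∘ emb m
      ; conn₁ = ConnectedIn-restrict conn₁ ; conn₂ = ConnectedIn-restrict conn₂
      ; conn₃ = ConnectedIn-restrict conn₃ ; conn₄ = ConnectedIn-restrict conn₄
      ; root₁ = root₁ ; root₂ = root₂ ; root₃ = root₃ ; root₄ = root₄
      ; disj₁₂ = disj₁₂ ∘ emb m ; disj₁₃ = disj₁₃ ∘ emb m ; disj₁₄ = disj₁₄ ∘ emb m
      ; disj₂₃ = disj₂₃ ∘ emb m ; disj₂₄ = disj₂₄ ∘ emb m ; disj₃₄ = disj₃₄ ∘ emb m
      ; join₁₂ = edge-between-restrict conn₁ conn₂ root₁ root₂ disj₁₂ join₁₂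
      ; join₁₃ = edge-between-restrict conn₁ conn₃ root₁ root₃ disj₁₃ join₁₃
      ; join₁₄ = edge-between-restrict conn₁ conn₄ root₁ root₄ disj₁₄ join₁₄
      ; join₂₃ = edge-between-restrict conn₂ conn₃ root₂ root₃ disj₂₃ join₂₃
      ; join₂₄ = edge-between-restrict conn₂ conn₄ root₂ root₄ disj₂₄ join₂₄
      ; join₃₄ = edge-between-restrict conn₃ conn₄ root₃ root₄ disj₃₄ join₃₄
      }
      where open K4MinorRooted K

lemma11 : ∀ {n} (H : Graph n) (a b c d : Fin n) →
          a ≢ b → a ≢ c → a ≢ d → b ≢ c → b ≢ d → c ≢ d →
          (m : ℕ) (τ : Fin m → Triangle H) →
          K4MinorRooted (H ⁺[ m , τ ]) (emb m a) (emb m b) (emb m c) (emb m d) ⇔ K4MinorRooted H a b c d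
lemma11 H a b c d _ _ _ _ _ _ m τ =
  mk⇔ (K4MinorRooted-restrict H m τ)
      (K4MinorRooted-image (emb m) (emb-hom H m τ) (λ {u} {v} → ↑ˡ-injective m u v))
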